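{- For $r,t\ge 1$, $$s(n,tK_{1,r})\le \mathrm{ex}\big(n,((4r+1)(t-1)+1)K_{1,5r-4}\big).$$ In particular, $s(n,tK_2)\le \mathrm{ex}(n,(5t-4)K_2)$.
   Context: $kG$ denotes the vertex-disjoint union of $k$ copies of $G$. For a graph $H$, $F_{H,0}$ is the set of maps $f:E(H)\to E(H)$ with $f(e)\cap e=\emptyset$ for every $e$. A subgraph $G'$ of $H$ is $f$-exclusive if $f(e)\cap V(G')=\emptyset$ for every $e\in E(G')$. $s(n,G)$ is the maximum number of edges of an $n$-vertex graph $H$ for which some $f\in F_{H,0}$ exists with no $f$-exclusive copy of $G$ in $H$. $\mathrm{ex}(n,\cdot)$ is the Turán number. -}

module Defs where

open import Data.Nat using (ℕ; zero; suc; _+_; _*_; _∸_; _≤_; _<_)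
open import Data.Bool using (Bool; true; false; _∧_; if_then_else_)
open import Data.Fin using (Fin; toℕ)
open import Data.List using (List; map; allFin)
open import Data.Nat.ListAction using (sum)
open import Data.Product using (Σ; _×_; _,_)
open import Data.Sum using (_⊎_)
open import Relation.Binary.PropositionalEquality using (_≡_; _≢_)
open import Relation.Nullary using (¬_)
open import Function.Definitions using (Injective)

record SimpleGraph (n : ℕ) : Set where
  field
    adj    : Fin n → Fin n → Bool
    sym    : ∀ i j → adj i j ≡ adj j i
    irrefl : ∀ i → adj i i ≡ false
open SimpleGraph public

-- An edge {lo , hi} of H, stored with toℕ lo < toℕ hi (so each edge once).
record Edge {n : ℕ} (H : SimpleGraph n) : Set where
  field
    lo   : Fin n
    hi   : Fin n
    lt   : toℕ lo < toℕ hi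
    isE  : adj H lo hi ≡ true
open Edge public

edgeCount : ∀ {n} → SimpleGraph n → ℕ
edgeCount {n} H =
  sum (map (λ i → sum (map (λ j →
    if (Data.Nat._<ᵇ_ (toℕ i) (toℕ j)) ∧ adj H i j then 1 else 0)
    (allFin n))) (allFin n))

_∈E_ : ∀ {n} {H : SimpleGraph n} → Fin n → Edge H → Set
v ∈E e = (v ≡ lo e) ⊎ (v ≡ hi e)

Ends : ∀ {n} {H : SimpleGraph n} → Edge H → Fin n → Fin n → Set
Ends e x y = (lo e ≡ x × hi e ≡ y) ⊎ (lo e ≡ y × hi e ≡ x)

InF0 : ∀ {n} (H : SimpleGraph n) → (Edge H → Edge H) → Set
InF0 H f = ∀ e v → v ∈E f e → ¬ (v ∈E e)

record Pattern : Set₁ where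
  field
    V : Set
    E : V → V → Set
open Pattern public

-- A copy of G in H: an injective map V(G) → V(H) sending edges to edges.
-- The copy is the subgraph with vertex set the image and edge set the image of E(G).
record Copy {n : ℕ} (H : SimpleGraph n) (G : Pattern) : Set where
  field
    φ     : V G → Fin n
    inj   : Injective _≡_ _≡_ φ
    hom   : ∀ u v → E G u v → adj H (φ u) (φ v) ≡ true
open Copy public

Exclusive : ∀ {n} {H : SimpleGraph n} {G : Pattern} →
            (Edge H → Edge H) → Copy H G → Set
Exclusive {H = H} {G = G} f c =
  ∀ u v → E G u v → ∀ (e : Edge H) → Ends e (φ c u) (φ c v) →
  ∀ w → ¬ (φ c w ∈E f e)

starForest : ℕ → ℕ → Pattern
starForest t r = record
  { V = Fin t × Fin (suc r)
  ; E = λ { (a , x) (b , y) →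
        a ≡ b × ((x ≡ Data.Fin.zero × y ≢ Data.Fin.zero) ⊎ (y ≡ Data.Fin.zero × x ≢ Data.Fin.zero)) } }

matching : ℕ → Pattern
matching t = record
  { V = Fin t × Fin 2
  ; E = λ { (a , x) (b , y) → a ≡ b × x ≢ y } }

-- "H has at most ex(n, G) edges" unfolded: some G-free n-vertex graph has
-- at least as many edges as H (ex is a maximum over a finite nonempty set).
AtMostEx : ∀ {n} → SimpleGraph n → Pattern → Set
AtMostEx {n} H G = Σ (SimpleGraph n) λ H' → ¬ Copy H' G × edgeCount H ≤ edgeCount H'

-- s(n, G) ≤ ex(n, G'), unfolded over the definition of s as a maximum.
sLeEx : Pattern → Pattern → Set
sLeEx G G' = ∀ n (H : SimpleGraph n) (f : Edge H → Edge H) → InF0 H f →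
  ¬ (Σ (Copy H G) (Exclusive f)) → AtMostEx H G'

module Submission where

-- Let f ∈ F_{H,0} and let H contain m = (4r+1)(t-1)+1 disjoint stars K_{1,5r-4}; we find an
-- f-exclusive t K_{1,r} among them, so H itself witnesses s(n, t K_{1,r}) ≤ ex(n, m K_{1,5r-4}).
-- Both selections use one greedy fact: a digraph of maximum out-degree d on more than
-- (2d+1)(k-1) vertices has k pairwise non-adjacent vertices (double counting gives a vertex of
-- in-degree at most d; drop it with its at most 2d neighbours and recurse).
-- Inside a star, the spoke to leaf j blocks leaf j' when f(spoke) contains j'; a spoke blocks
-- at most two leaves, so r mutually unblocked leaves remain out of 5r-4. The centre lies on
-- every spoke and hence on none of their f-images, as f(e) ∩ e = ∅. Across stars, a blocks b
-- when the f-image of a chosen spoke of a meets b; each of the r images meets at most two stars,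
-- so a blocks at most 2r stars and t mutually unblocked stars remain. These t stars with their
-- chosen leaves form the f-exclusive copy. The matching case is r = 1.

open import Axiom.UniquenessOfIdentityProofs using (module Decidable⇒UIP)
open import Data.Bool.Base using (true; false; if_then_else_)
open import Data.Bool.Properties using () renaming (_≟_ to _≟ᴮ_)
open import Data.Fin.Base using (Fin; zero; suc; toℕ; lift)
open import Data.Fin.Properties using (any?; lift-injective; toℕ-injective; suc-injective)
  renaming (_≟_ to _≟ᶠ_)
open import Data.List.Base using (List; []; _∷_; length; filter; map; allFin)
open import Data.List.Membership.Propositional using (_∈_; find)
open import Data.List.Membership.Propositional.Properties using (∈-filter⁻)
open import Data.List.Properties using (length-map; length-tabulate)
open import Data.List.Relation.Unary.All as All using (All; []; _∷_)
open import Data.List.Relation.Unary.All.Properties as All using (all-filter; ¬Any⇒All¬)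
open import Data.List.Relation.Unary.AllPairs using (_∷_)
open import Data.List.Relation.Unary.Any as Any using (Any)
open import Data.List.Relation.Unary.Unique.Propositional using (Unique)
open import Data.List.Relation.Unary.Unique.Propositional.Properties as Unique using (allFin⁺)
open import Data.Nat.Base using (ℕ; zero; suc; _+_; _*_; _∸_; _≤_; _<_; z≤n; s≤s)
open import Data.Nat.ListAction using (sum)
open import Data.Nat.Properties hiding (suc-injective)
open import Algebra.Properties.CommutativeSemigroup +-commutativeSemigroup using (interchange)
open import Data.Nat.Tactic.RingSolver using (solve-∀)
open import Data.Product.Base using (Σ; ∃; _×_; _,_; proj₁; proj₂)
open import Data.Product.Properties using (,-injective)
open import Data.Sum.Base using (_⊎_; inj₁; inj₂)
open import Function.Base using (_∘_)
open import Function.Definitions using (Injective)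
open import Level using (0ℓ)
open import Relation.Binary.Definitions using (DecidableEquality; tri<; tri≈; tri>)
open import Relation.Binary.PropositionalEquality
open import Relation.Nullary using (¬_; Dec; yes; no; does; contradiction)
open import Relation.Nullary.Decidable using (_⊎-dec_)
open import Relation.Unary using (Pred; Decidable; _∪_)
open import Relation.Unary.Properties using (∁?; _∪?_)

open import Defs hiding (sym)

private variable
  A B : Set
  G G′ : Pattern

sum-map-zero : (xs : List A) → sum (map (λ _ → 0) xs) ≡ 0
sum-map-zero []       = refl
sum-map-zero (_ ∷ xs) = sum-map-zero xs

sum-map-+ : (g h : A → ℕ) (xs : List A) →
            sum (map (λ x → g x + h x) xs) ≡ sum (map g xs) + sum (map h xs)
sum-map-+ g h []       = refl
sum-map-+ g h (x ∷ xs) = trans (cong (g x + h x +_) (sum-map-+ g h xs)) (interchange (g x) (h x) _ _)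

sum-map-comm : (h : A → B → ℕ) (xs : List A) (ys : List B) →
               sum (map (λ x → sum (map (h x) ys)) xs) ≡ sum (map (λ y → sum (map (λ x → h x y) xs)) ys)
sum-map-comm h []       ys = sym (sum-map-zero ys)
sum-map-comm h (x ∷ xs) ys = trans (cong (sum (map (h x) ys) +_) (sum-map-comm h xs ys))
                                   (sym (sum-map-+ (h x) _ ys))

sum-map-≤ : {d : ℕ} (h : A → ℕ) → (∀ x → h x ≤ d) → (xs : List A) → sum (map h xs) ≤ length xs * d
sum-map-≤ h h≤ []       = z≤n
sum-map-≤ h h≤ (x ∷ xs) = +-mono-≤ (h≤ x) (sum-map-≤ h h≤ xs)

sum-map-≥ : {c : ℕ} (h : A → ℕ) {xs : List A} → All (λ x → c ≤ h x) xs → length xs * c ≤ sum (map h xs)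
sum-map-≥ h []         = z≤n
sum-map-≥ h (c≤ ∷ c≤s) = +-mono-≤ c≤ (sum-map-≥ h c≤s)

below-average : {d : ℕ} (h : A → ℕ) (xs : List A) → 0 < length xs →
                sum (map h xs) ≤ length xs * d → Any (λ x → h x ≤ d) xs
below-average {d = d} h xs nonempty sum≤ with Any.any? (λ x → h x ≤? d) xs
... | yes some = some
... | no none  = contradiction (≤-trans (sum-map-≥ h (All.map ≰⇒> (¬Any⇒All¬ xs none))) sum≤)
                               (<⇒≱ (subst (length xs * d <_) (sym (*-suc (length xs) d)) (m<n+m _ nonempty)))

count : {P : Pred A 0ℓ} → Decidable P → List A → ℕ
count P? xs = sum (map (λ x → if does (P? x) then 1 else 0) xs)

count≡length-filter : {P : Pred A 0ℓ} (P? : Decidable P) (xs : List A) → count P? xs ≡ length (filter P? xs)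
count≡length-filter P? []       = refl
count≡length-filter P? (x ∷ xs) with does (P? x)
... | true  = cong suc (count≡length-filter P? xs)
... | false = count≡length-filter P? xs

length≡count+count∁ : {P : Pred A 0ℓ} (P? : Decidable P) (xs : List A) → length xs ≡ count P? xs + count (∁? P?) xs
length≡count+count∁ P? []       = refl
length≡count+count∁ P? (x ∷ xs) with does (P? x)
... | true  = cong suc (length≡count+count∁ P? xs)
... | false = trans (cong suc (length≡count+count∁ P? xs)) (sym (+-suc _ _))

count-∪ : {P Q : Pred A 0ℓ} (P? : Decidable P) (Q? : Decidable Q) (xs : List A) →
          count (P? ∪? Q?) xs ≤ count P? xs + count Q? xs
count-∪ P? Q? []       = z≤n
count-∪ P? Q? (x ∷ xs) with does (P? x) | does (Q? x)
... | true  | true  = s≤s (≤-trans (count-∪ P? Q? xs) (+-monoʳ-≤ _ (n≤1+n _)))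
... | true  | false = s≤s (count-∪ P? Q? xs)
... | false | true  = ≤-trans (s≤s (count-∪ P? Q? xs)) (≤-reflexive (sym (+-suc _ _)))
... | false | false = count-∪ P? Q? xs

AtMost : ℕ → Pred A 0ℓ → Set
AtMost d P = ∀ {xs} → Unique xs → All P xs → length xs ≤ d

atMost-mono : ∀ {d} {P Q : Pred A 0ℓ} → (∀ {x} → Q x → P x) → AtMost d P → AtMost d Q
atMost-mono Q⊆P P≤ uniq all = P≤ uniq (All.map Q⊆P all)

atMost-subsingleton : {P : Pred A 0ℓ} → (∀ {x y} → P x → P y → x ≡ y) → AtMost 1 P
atMost-subsingleton P! {[]}          _               _              = z≤n
atMost-subsingleton P! {_ ∷ []}      _               _              = s≤s z≤n
atMost-subsingleton P! {_ ∷ _ ∷ _} ((x≢y ∷ _) ∷ _) (px ∷ py ∷ _) = contradiction (P! px py) x≢y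

atMost-preimage : ∀ {d} {S : Pred B 0ℓ} {g : A → B} →
                  Injective _≡_ _≡_ g → AtMost d S → AtMost d (S ∘ g)
atMost-preimage {g = g} g-inj S≤ {xs} uniq all =
  subst (_≤ _) (length-map g xs) (S≤ (Unique.map⁺ g-inj uniq) (All.map⁺ all))

count≤ : ∀ {d} {P : Pred A 0ℓ} (P? : Decidable P) → AtMost d P → ∀ {xs} → Unique xs → count P? xs ≤ d
count≤ P? P≤ {xs} uniq =
  subst (_≤ _) (sym (count≡length-filter P? xs)) (P≤ (Unique.filter⁺ P? uniq) (all-filter P? xs))

atMost-∪ : ∀ {a b} {P Q : Pred A 0ℓ} → Decidable P → AtMost a P → AtMost b Q → AtMost (a + b) (P ∪ Q)
atMost-∪ {a = a} {b} {P} {Q} P? P≤ Q≤ {xs} uniq all = begin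
  length xs                                 ≡⟨ length≡count+count∁ P? xs ⟩
  count P? xs + count (∁? P?) xs            ≡⟨ cong (count P? xs +_) (count≡length-filter (∁? P?) xs) ⟩
  count P? xs + length (filter (∁? P?) xs)  ≤⟨ +-mono-≤ (count≤ P? P≤ uniq) Q-part ⟩
  a + b                                     ∎
  where
  open ≤-Reasoning
  onlyQ : ∀ {x} → (P ∪ Q) x × ¬ P x → Q x
  onlyQ (inj₁ p , ¬p) = contradiction p ¬p
  onlyQ (inj₂ q , _)  = q
  Q-part : length (filter (∁? P?) xs) ≤ b
  Q-part = Q≤ (Unique.filter⁺ (∁? P?) uniq)
              (All.zipWith onlyQ (All.filter⁺ (∁? P?) all , all-filter (∁? P?) xs))

atMost-∃ : {k c : ℕ} {Q : Fin k → Pred A 0ℓ} → (∀ i → Decidable (Q i)) →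
           (∀ i → AtMost c (Q i)) → AtMost (k * c) (λ x → ∃ λ i → Q i x)
atMost-∃ {k = zero}  Q? Q≤ {[]}    _ _             = z≤n
atMost-∃ {k = zero}  Q? Q≤ {_ ∷ _} _ ((() , _) ∷ _)
atMost-∃ {k = suc k} {Q = Q} Q? Q≤ =
  atMost-mono split (atMost-∪ (Q? zero) (Q≤ zero) (atMost-∃ (Q? ∘ suc) (Q≤ ∘ suc)))
  where
  split : ∀ {x} → ∃ (λ i → Q i x) → Q zero x ⊎ ∃ (λ i → Q (suc i) x)
  split (zero  , q) = inj₁ q
  split (suc i , q) = inj₂ (i , q)

record IndependentSubset (R : A → A → Set) (k : ℕ) (xs : List A) : Set where
  field
    element           : Fin k → A
    element-∈         : ∀ i → element i ∈ xs
    element-injective : Injective _≡_ _≡_ element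
    independent       : ∀ {i j} → i ≢ j → ¬ R (element i) (element j)

module _ (_≟_ : DecidableEquality A) {R : A → A → Set} (R? : ∀ u v → Dec (R u v))
         {d : ℕ} (outdegree≤ : ∀ u → AtMost d (R u)) where

  indegree : List A → A → ℕ
  indegree xs v = count (λ u → R? u v) xs

  private
    Near : A → Pred A 0ℓ
    Near v u = u ≡ v ⊎ R v u ⊎ R u v

    near? : ∀ v → Decidable (Near v)
    near? v = (_≟ v) ∪? ((R? v) ∪? (λ u → R? u v))

  lowIndegree : ∀ {xs} → Unique xs → 0 < length xs → Any (λ v → indegree xs v ≤ d) xs
  lowIndegree {xs} uniq nonempty = below-average (indegree xs) xs nonempty (begin
    sum (map (indegree xs) xs)            ≡⟨ sum-map-comm (λ v u → if does (R? u v) then 1 else 0) xs xs ⟩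
    sum (map (λ u → count (R? u) xs) xs)  ≤⟨ sum-map-≤ _ (λ u → count≤ (R? u) (outdegree≤ u) uniq) xs ⟩
    length xs * d                         ∎)
    where open ≤-Reasoning

  private
    near≤ : ∀ {v xs} → Unique xs → indegree xs v ≤ d → count (near? v) xs ≤ suc (d + d)
    near≤ {v} {xs} uniq indegree≤ =
      ≤-trans (count-∪ (_≟ v) ((R? v) ∪? (λ u → R? u v)) xs)
        (+-mono-≤ (count≤ (_≟ v) (atMost-subsingleton (λ x≡v y≡v → trans x≡v (sym y≡v))) uniq)
          (≤-trans (count-∪ (R? v) (λ u → R? u v) xs)
            (+-mono-≤ (count≤ (R? v) (outdegree≤ v) uniq) indegree≤)))

    insert : ∀ {k v xs} → v ∈ xs → IndependentSubset R k (filter (∁? (near? v)) xs) →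
             IndependentSubset R (suc k) xs
    insert {v = v} {xs} v∈xs S = record
      { element = element ; element-∈ = element-∈
      ; element-injective = injective ; independent = independent }
      where
      module S = IndependentSubset S
      kept : ∀ i → S.element i ∈ xs × ¬ Near v (S.element i)
      kept i = ∈-filter⁻ (∁? (near? v)) (S.element-∈ i)
      element : Fin _ → A
      element zero    = v
      element (suc i) = S.element i
      element-∈ : ∀ i → element i ∈ xs
      element-∈ zero    = v∈xs
      element-∈ (suc i) = proj₁ (kept i)
      injective : Injective _≡_ _≡_ element
      injective {zero}  {zero}  _  = refl
      injective {zero}  {suc j} eq = contradiction (inj₁ (sym eq)) (proj₂ (kept j))
      injective {suc i} {zero}  eq = contradiction (inj₁ eq) (proj₂ (kept i))
      injective {suc i} {suc j} eq = cong suc (S.element-injective eq)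
      independent : ∀ {i j} → i ≢ j → ¬ R (element i) (element j)
      independent {zero}  {zero}  i≢j = contradiction refl i≢j
      independent {zero}  {suc j} _   r = proj₂ (kept j) (inj₂ (inj₁ r))
      independent {suc i} {zero}  _   r = proj₂ (kept i) (inj₂ (inj₂ r))
      independent {suc i} {suc j} i≢j = S.independent (i≢j ∘ cong suc)

    singleton : ∀ {v xs} → v ∈ xs → IndependentSubset R 1 xs
    singleton {v} v∈xs = record
      { element = λ _ → v ; element-∈ = λ _ → v∈xs
      ; element-injective = λ { {zero} {zero} _ → refl }
      ; independent = λ { {zero} {zero} i≢j → contradiction refl i≢j } }

  independentSubset : ∀ k {xs} → Unique xs → suc (d + d) * k < length xs →
                      IndependentSubset R (suc k) xs
  independentSubset k {xs} uniq large with find (lowIndegree uniq (≤-trans (s≤s z≤n) large))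
  ... | v , v∈xs , indegree≤ with k
  ...   | zero  = singleton v∈xs
  ...   | suc k = insert v∈xs (independentSubset k (Unique.filter⁺ (∁? (near? v)) uniq) remaining)
    where
    open ≤-Reasoning
    remaining : suc (d + d) * k < length (filter (∁? (near? v)) xs)
    remaining = +-cancelˡ-< (suc (d + d)) _ _ (begin-strict
      suc (d + d) + suc (d + d) * k                    ≡⟨ *-suc (suc (d + d)) k ⟨
      suc (d + d) * suc k                              <⟨ large ⟩
      length xs                                        ≡⟨ length≡count+count∁ (near? v) xs ⟩
      count (near? v) xs + count (∁? (near? v)) xs     ≤⟨ +-mono-≤ (near≤ uniq indegree≤)
                                                            (≤-reflexive (count≡length-filter _ xs)) ⟩
      suc (d + d) + length (filter (∁? (near? v)) xs)  ∎)

module _ {n : ℕ} {H : SimpleGraph n} where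

  edge-≡ : ∀ {e e′ : Edge H} → lo e ≡ lo e′ → hi e ≡ hi e′ → e ≡ e′
  edge-≡ {record { lt = lt ; isE = isE }} {record { lt = lt′ ; isE = isE′ }} refl refl
    rewrite <-irrelevant lt lt′ | Decidable⇒UIP.≡-irrelevant _≟ᴮ_ isE isE′ = refl

  Ends-unique : ∀ {e e′ : Edge H} {x y} → Ends e x y → Ends e′ x y → e ≡ e′
  Ends-unique (inj₁ (refl , refl)) (inj₁ (lo≡ , hi≡)) = edge-≡ (sym lo≡) (sym hi≡)
  Ends-unique (inj₂ (refl , refl)) (inj₂ (lo≡ , hi≡)) = edge-≡ (sym lo≡) (sym hi≡)
  Ends-unique {e} {e′} (inj₁ (refl , refl)) (inj₂ (lo≡ , hi≡)) =
    contradiction (subst₂ (λ u v → toℕ u < toℕ v) lo≡ hi≡ (lt e′)) (<-asym (lt e))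
  Ends-unique {e} {e′} (inj₂ (refl , refl)) (inj₁ (lo≡ , hi≡)) =
    contradiction (subst₂ (λ u v → toℕ u < toℕ v) lo≡ hi≡ (lt e′)) (<-asym (lt e))

  Ends-sym : ∀ {e : Edge H} {x y} → Ends e x y → Ends e y x
  Ends-sym (inj₁ ends) = inj₂ ends
  Ends-sym (inj₂ ends) = inj₁ ends

  Ends⇒∈E : ∀ {e : Edge H} {x y} → Ends e x y → x ∈E e
  Ends⇒∈E (inj₁ (lo≡x , _)) = inj₁ (sym lo≡x)
  Ends⇒∈E (inj₂ (_ , hi≡x)) = inj₂ (sym hi≡x)

  edgeBetween : ∀ {x y} → adj H x y ≡ true → Σ (Edge H) λ e → Ends e x y
  edgeBetween {x} {y} xy with <-cmp (toℕ x) (toℕ y)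
  ... | tri< x<y _ _ = record { lo = x ; hi = y ; lt = x<y ; isE = xy } , inj₁ (refl , refl)
  ... | tri> _ _ y<x =
    record { lo = y ; hi = x ; lt = y<x ; isE = trans (SimpleGraph.sym H y x) xy } , inj₂ (refl , refl)
  ... | tri≈ _ x≡y _ with toℕ-injective x≡y
  ...   | refl = contradiction (trans (sym xy) (irrefl H x)) λ ()

  _∈E?_ : ∀ v (e : Edge H) → Dec (v ∈E e)
  v ∈E? e = (v ≟ᶠ lo e) ⊎-dec (v ≟ᶠ hi e)

  endpoints≤2 : ∀ (e : Edge H) → AtMost 2 (_∈E e)
  endpoints≤2 e = atMost-∪ (_≟ᶠ lo e) (atMost-subsingleton λ x≡ y≡ → trans x≡ (sym y≡))
                                       (atMost-subsingleton λ x≡ y≡ → trans x≡ (sym y≡))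

record Embedding (G G′ : Pattern) : Set where
  field
    embed           : V G → V G′
    embed-injective : Injective _≡_ _≡_ embed
    embed-edge      : ∀ u v → E G u v → E G′ (embed u) (embed v)
open Embedding

module _ {n : ℕ} {H : SimpleGraph n} where

  restrict : Embedding G G′ → Copy H G′ → Copy H G
  restrict ι C = record
    { φ   = φ C ∘ embed ι
    ; inj = embed-injective ι ∘ inj C
    ; hom = λ u v uv → hom C _ _ (embed-edge ι u v uv) }

  restrict-exclusive : ∀ {f : Edge H → Edge H} → Embedding G G′ →
                       Σ (Copy H G′) (Exclusive f) → Σ (Copy H G) (Exclusive f)
  restrict-exclusive ι (C , excl) =
    restrict ι C , λ u v uv e ends w → excl _ _ (embed-edge ι u v uv) e ends (embed ι w)

matching↪starForest : ∀ t → Embedding (matching t) (starForest t 1)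
matching↪starForest t = record { embed = λ u → u ; embed-injective = λ eq → eq ; embed-edge = edge }
  where
  edge : ∀ u v → E (matching t) u v → E (starForest t 1) u v
  edge (_ , zero)     (_ , zero)     (_    , x≢y) = contradiction refl x≢y
  edge (_ , zero)     (_ , suc zero) (a≡b , _)   = a≡b , inj₁ (refl , λ ())
  edge (_ , suc zero) (_ , zero)     (a≡b , _)   = a≡b , inj₂ (refl , λ ())
  edge (_ , suc zero) (_ , suc zero) (_    , x≢y) = contradiction refl x≢y

starForest↪matching : ∀ t → Embedding (starForest t 1) (matching t)
starForest↪matching t = record { embed = λ u → u ; embed-injective = λ eq → eq ; embed-edge = edge }
  where
  edge : ∀ u v → E (starForest t 1) u v → E (matching t) u v
  edge _ _ (a≡b , inj₁ (x≡0 , y≢0)) = a≡b , λ x≡y → y≢0 (trans (sym x≡y) x≡0)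
  edge _ _ (a≡b , inj₂ (y≡0 , x≢0)) = a≡b , λ x≡y → x≢0 (trans x≡y y≡0)

subforest : ∀ {t r m s} {τ : Fin t → Fin m} → Injective _≡_ _≡_ τ →
            (σ : Fin t → Fin r → Fin s) → (∀ p → Injective _≡_ _≡_ (σ p)) →
            Embedding (starForest t r) (starForest m s)
subforest {t} {r} {m} {s} {τ} τ-injective σ σ-injective = record
  { embed = embed′ ; embed-injective = injective ; embed-edge = edge }
  where
  -- lift 1 (σ p) fixes the centre zero and sends leaf suc i to suc (σ p i).
  embed′ : Fin t × Fin (suc r) → Fin m × Fin (suc s)
  embed′ (p , y) = τ p , lift 1 (σ p) y
  lift-injective′ : ∀ p → Injective _≡_ _≡_ (lift 1 (σ p))
  lift-injective′ p = lift-injective (σ p) (σ-injective p) 1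
  injective : Injective _≡_ _≡_ embed′
  injective {p , y} {p′ , y′} eq with ,-injective eq
  ... | τp≡τp′ , y↦≡ with τ-injective {p} {p′} τp≡τp′
  ...   | refl = cong (p ,_) (lift-injective′ p y↦≡)
  edge : ∀ u v → E (starForest _ _) u v → E (starForest _ _) (embed′ u) (embed′ v)
  edge (p , _) (_ , y) (refl , inj₁ (refl , y≢0)) = refl , inj₁ (refl , y≢0 ∘ lift-injective′ p)
  edge (p , x) (_ , _) (refl , inj₂ (refl , x≢0)) = refl , inj₂ (refl , x≢0 ∘ lift-injective′ p)

-- Here r and t are one less than the paper's: t + 1 stars with r + 1 leaves each are selected.
module Selection {n : ℕ} {H : SimpleGraph n} (f : Edge H → Edge H) (f∈F₀ : InF0 H f)
                 {m s r t : ℕ} (5r<s : 5 * r < s) (manyStars : (4 * suc r + 1) * t < m)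
                 (C : Copy H (starForest m s)) where

  centre : Fin m → Fin n
  centre a = φ C (a , zero)

  leaf : Fin m → Fin s → Fin n
  leaf a j = φ C (a , suc j)

  leaf-injective : ∀ a → Injective _≡_ _≡_ (leaf a)
  leaf-injective a = suc-injective ∘ proj₂ ∘ ,-injective ∘ inj C

  -- The spokes and the greedy choices are used only through their specifications; left
  -- transparent, conversion checking unfolds them and becomes infeasibly slow.
  opaque
    spoke : Fin m → Fin s → Edge H
    spoke a j = proj₁ (edgeBetween (hom C (a , zero) (a , suc j) (refl , inj₁ (refl , λ ()))))

    spoke-ends : ∀ a j → Ends (spoke a j) (centre a) (leaf a j)
    spoke-ends a j = proj₂ (edgeBetween (hom C (a , zero) (a , suc j) (refl , inj₁ (refl , λ ()))))

  centre∈spoke : ∀ a j → centre a ∈E spoke a j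
  centre∈spoke a j = Ends⇒∈E {e = spoke a j} {y = leaf a j} (spoke-ends a j)

  leaf∈spoke : ∀ a j → leaf a j ∈E spoke a j
  leaf∈spoke a j =
    Ends⇒∈E {e = spoke a j} {y = centre a} (Ends-sym {e = spoke a j} {x = centre a} (spoke-ends a j))

  LeafConflict : Fin m → Fin s → Fin s → Set
  LeafConflict a j j′ = leaf a j′ ∈E f (spoke a j)

  opaque
    chosenLeaves : ∀ a → IndependentSubset (LeafConflict a) (suc r) (allFin s)
    chosenLeaves a =
      independentSubset _≟ᶠ_ (λ j j′ → leaf a j′ ∈E? f (spoke a j))
        (λ j → atMost-preimage (leaf-injective a) (endpoints≤2 (f (spoke a j))))
        r (allFin⁺ s) (subst (5 * r <_) (sym (length-tabulate (λ j → j))) 5r<s)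

  σ : Fin m → Fin (suc r) → Fin s
  σ a = IndependentSubset.element (chosenLeaves a)

  σ-injective : ∀ a → Injective _≡_ _≡_ (σ a)
  σ-injective a = IndependentSubset.element-injective (chosenLeaves a)

  leaves-independent : ∀ a {i j} → i ≢ j → ¬ LeafConflict a (σ a i) (σ a j)
  leaves-independent a = IndependentSubset.independent (chosenLeaves a)

  selectedSpoke : Fin m → Fin (suc r) → Edge H
  selectedSpoke a i = spoke a (σ a i)

  Meets : Edge H → Fin m → Set
  Meets e b = ∃ λ w → φ C (b , w) ∈E e

  meets? : ∀ e → Decidable (Meets e)
  meets? e b = any? (λ w → φ C (b , w) ∈E? e)

  meets≤2 : ∀ e → AtMost 2 (Meets e)
  meets≤2 e = atMost-mono split
    (atMost-∪ (λ b → any? (λ w → φ C (b , w) ≟ᶠ lo e))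
              (atMost-subsingleton star-unique) (atMost-subsingleton star-unique))
    where
    split : ∀ {b} → Meets e b → (∃ λ w → φ C (b , w) ≡ lo e) ⊎ (∃ λ w → φ C (b , w) ≡ hi e)
    split (w , inj₁ eq) = inj₁ (w , eq)
    split (w , inj₂ eq) = inj₂ (w , eq)
    star-unique : ∀ {x b b′} → (∃ λ w → φ C (b , w) ≡ x) → (∃ λ w → φ C (b′ , w) ≡ x) → b ≡ b′
    star-unique (_ , eq) (_ , eq′) = proj₁ (,-injective (inj C (trans eq (sym eq′))))

  StarConflict : Fin m → Fin m → Set
  StarConflict a b = ∃ λ i → Meets (f (selectedSpoke a i)) b

  opaque
    chosenStars : IndependentSubset StarConflict (suc t) (allFin m)
    chosenStars =
      independentSubset _≟ᶠ_ (λ a b → any? (λ i → meets? (f (selectedSpoke a i)) b))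
        (λ a → atMost-∃ (λ i → meets? (f (selectedSpoke a i)))
                        (λ i → meets≤2 (f (selectedSpoke a i))))
        t (allFin⁺ m) (subst₂ _<_ (bound r t) (sym (length-tabulate (λ a → a))) manyStars)
      where
      bound : ∀ r t → (4 * suc r + 1) * t ≡ suc (suc r * 2 + suc r * 2) * t
      bound = solve-∀

  open IndependentSubset chosenStars using ()
    renaming (element to τ; element-injective to τ-injective; independent to stars-independent)

  selection : Copy H (starForest (suc t) (suc r))
  selection = restrict (subforest {τ = τ} τ-injective (σ ∘ τ) (σ-injective ∘ τ)) C

  otherStar-exclusive : ∀ {p q} → p ≢ q → ∀ i → ¬ Meets (f (selectedSpoke (τ p) i)) (τ q)
  otherStar-exclusive p≢q i meets = stars-independent p≢q (i , meets)

  sameStar-exclusive : ∀ p i y → ¬ (φ C (τ p , lift 1 (σ (τ p)) y) ∈E f (selectedSpoke (τ p) i))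
  sameStar-exclusive p i zero w∈fe =
    f∈F₀ (selectedSpoke (τ p) i) (centre (τ p)) w∈fe (centre∈spoke (τ p) (σ (τ p) i))
  sameStar-exclusive p i (suc i′) with i′ ≟ᶠ i
  ... | yes refl = λ w∈fe →
    f∈F₀ (selectedSpoke (τ p) i) (leaf (τ p) (σ (τ p) i)) w∈fe (leaf∈spoke (τ p) (σ (τ p) i))
  ... | no i′≢i  = leaves-independent (τ p) (i′≢i ∘ sym)

  selectedSpoke-exclusive : ∀ p i w → ¬ (φ selection w ∈E f (selectedSpoke (τ p) i))
  selectedSpoke-exclusive p i (q , y) with q ≟ᶠ p
  ... | yes refl = sameStar-exclusive p i y
  ... | no q≢p   = λ w∈fe → otherStar-exclusive (q≢p ∘ sym) i (_ , w∈fe)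

  selection-exclusive : Exclusive f selection
  selection-exclusive (p , zero) (_ , suc i) (refl , _) e ends w =
    subst (λ e → ¬ (φ selection w ∈E f e)) (Ends-unique (spoke-ends (τ p) (σ (τ p) i)) ends)
          (selectedSpoke-exclusive p i w)
  selection-exclusive (p , suc i) (_ , zero) (refl , _) e ends w =
    subst (λ e → ¬ (φ selection w ∈E f e))
          (Ends-unique (spoke-ends (τ p) (σ (τ p) i)) (Ends-sym {e = e} {x = leaf (τ p) (σ (τ p) i)} ends))
          (selectedSpoke-exclusive p i w)
  selection-exclusive (_ , zero)  (_ , zero)  (refl , inj₁ (_ , y≢0)) = contradiction refl y≢0
  selection-exclusive (_ , zero)  (_ , zero)  (refl , inj₂ (_ , x≢0)) = contradiction refl x≢0
  selection-exclusive (_ , suc _) (_ , suc _) (refl , inj₁ (() , _))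
  selection-exclusive (_ , suc _) (_ , suc _) (refl , inj₂ (() , _))

exclusiveSubforest : ∀ {n} {H : SimpleGraph n} (f : Edge H → Edge H) → InF0 H f →
                     ∀ {m s} r t → 5 * r < s → (4 * suc r + 1) * t < m →
                     Copy H (starForest m s) → Σ (Copy H (starForest (suc t) (suc r))) (Exclusive f)
exclusiveSubforest f f∈F₀ r t 5r<s manyStars C = selection , selection-exclusive
  where open Selection f f∈F₀ {r = r} {t} 5r<s manyStars C

sLeEx-of-free : (∀ {n} (H : SimpleGraph n) f → InF0 H f →
                 ¬ Σ (Copy H G) (Exclusive f) → ¬ Copy H G′) → sLeEx G G′
sLeEx-of-free free n H f f∈F₀ noExclusive = H , free H f f∈F₀ noExclusive , ≤-refl

proposition4p5 : (∀ (r t : ℕ) → 1 ≤ r → 1 ≤ t →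
    sLeEx (starForest t r) (starForest (((4 * r + 1) * (t ∸ 1)) + 1) (5 * r ∸ 4)))
    × (∀ (t : ℕ) → 1 ≤ t → sLeEx (matching t) (matching (5 * t ∸ 4)))
proposition4p5 = starForests , matchings
  where
  5r<5[1+r]∸4 : ∀ r → 5 * r < 5 * suc r ∸ 4
  5r<5[1+r]∸4 r = ≤-reflexive (sym (cong (_∸ 4) (*-suc 5 r)))

  starForests : ∀ r t → 1 ≤ r → 1 ≤ t →
    sLeEx (starForest t r) (starForest (((4 * r + 1) * (t ∸ 1)) + 1) (5 * r ∸ 4))
  starForests (suc r) (suc t) _ _ = sLeEx-of-free λ H f f∈F₀ noExclusive C →
    noExclusive (exclusiveSubforest f f∈F₀ r t (5r<5[1+r]∸4 r) (m<m+n _ (s≤s z≤n)) C)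

  matchings : ∀ t → 1 ≤ t → sLeEx (matching t) (matching (5 * t ∸ 4))
  matchings (suc t) _ = sLeEx-of-free λ H f f∈F₀ noExclusive C →
    noExclusive (restrict-exclusive {f = f} (matching↪starForest (suc t))
      (exclusiveSubforest f f∈F₀ 0 t (s≤s z≤n) (5r<5[1+r]∸4 t)
        (restrict (starForest↪matching (5 * suc t ∸ 4)) C)))
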